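{- Let $k\ge 2$, $a\ge 1$, $b\ge 0$ be integers with $(a,b)\ne(1,0)$. Then the Rado number $\operatorname{R}_k(y=ax+b)$ does not exist.
   Context: All colorings are exact: an exact $k$-coloring of $[N]=\{1,\dots,N\}$ is a surjective map $[N]\to[k]$ (so $N\ge k$). A monochromatic solution of $y=ax+b$ in $[N]$ is a pair $(x_0,y_0)$ with $x_0,y_0\in[N]$, $y_0=ax_0+b$, and $x_0,y_0$ of the same color. The Rado number $\operatorname{R}_k(\mathcal{E})$ is the minimum integer $N\ge k$, if it exists, such that every exact $k$-coloring of $[N]$ contains a monochromatic solution of $\mathcal{E}$. -}

module Defs where

open import Data.Nat using (ℕ; suc; _+_; _*_; _≤_)
open import Data.Fin using (Fin; toℕ)
open import Data.Product using (Σ; ∃; ∃-syntax; _×_)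
open import Relation.Binary.PropositionalEquality using (_≡_)

-- [N] = {1,…,N} is represented by Fin N, with i : Fin N standing for toℕ i + 1.
val : {N : ℕ} → Fin N → ℕ
val i = suc (toℕ i)

IsExactColoring : (N k : ℕ) → (Fin N → Fin k) → Set
IsExactColoring N k c = ∀ (j : Fin k) → ∃[ i ] c i ≡ j

HasMonoSolution : (N k a b : ℕ) → (Fin N → Fin k) → Set
HasMonoSolution N k a b c =
  ∃[ x ] ∃[ y ] (val y ≡ a * val x + b) × (c x ≡ c y)

RadoProperty : (k a b N : ℕ) → Set
RadoProperty k a b N =
  k ≤ N × (∀ (c : Fin N → Fin k) → IsExactColoring N k c → HasMonoSolution N k a b c)

-- R_k(y = ax+b) is the minimum N with the Rado property; it exists iff
-- some N has the property (ℕ is well-ordered).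
RadoNumberExists : (k a b : ℕ) → Set
RadoNumberExists k a b = ∃[ N ] RadoProperty k a b N

-- Along any solution y = a x + b in positive integers x < y, since x ↦ a x + b
-- is expanding unless (a, b) = (1, 0). So for every N ≥ k ≥ 2 there is an exact
-- k-coloring of [N] without monochromatic solutions: color an initial segment
-- with few colors and give every remaining number a color of its own. If
-- a + b ≤ N - k + 2, the segment [N - k + 2] is colored by the parity of the
-- length of the backward orbit under x ↦ a x + b, which flips along every
-- solution; otherwise [N - k + 1] lies below a + b, contains no solution, and
-- gets a single color.
module Submission where

open import Defs
open import Data.Nat
  using (ℕ; zero; suc; _+_; _*_; _∸_; _≤_; _<_; z≤n; s≤s; z<s; _≟_; _≤?_)
open import Data.Nat.Properties
open import Data.Nat.DivMod using (_/_; m*n/n≡m)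
open import Data.Fin using (Fin; zero; suc; toℕ; fromℕ; fromℕ<; inject₁; opposite)
open import Data.Fin.Properties
  using (toℕ<n; toℕ-fromℕ; toℕ-fromℕ<; toℕ-inject₁; fromℕ≢inject₁; inject₁-injective)
open import Data.Fin.Relation.Unary.Top using (view; ‵fromℕ; ‵inj₁; view-fromℕ; view-inject₁)
open import Data.Product using (∃-syntax; _×_; _,_)
open import Relation.Binary.PropositionalEquality
open import Relation.Nullary using (¬_; Dec; yes; no; contradiction)

Expanding : ℕ → ℕ → Set
Expanding a b = ∀ n → suc n < a * suc n + b

expanding : ∀ {a b} → 1 ≤ a → ¬ (a ≡ 1 × b ≡ 0) → Expanding a b
expanding {suc zero} {zero} _ a,b≢1,0 _ = contradiction (refl , refl) a,b≢1,0
expanding {suc zero} {suc b} _ _ n = begin-strict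
  suc n              <⟨ m<m+n (suc n) z<s ⟩
  suc n + suc b      ≡⟨ cong (_+ suc b) (sym (*-identityˡ (suc n))) ⟩
  1 * suc n + suc b  ∎
  where open ≤-Reasoning
expanding {suc (suc a)} {b} _ _ n = begin-strict
  suc n                    <⟨ m<m+n (suc n) z<s ⟩
  suc n + suc n            ≤⟨ +-monoʳ-≤ (suc n) (m≤m+n (suc n) (a * suc n)) ⟩
  suc (suc a) * suc n      ≤⟨ m≤m+n _ b ⟩
  suc (suc a) * suc n + b  ∎
  where open ≤-Reasoning

record SolutionFreeColoring (N k a b : ℕ) : Set where
  constructor mkSolutionFree
  field
    coloring : Fin N → Fin k
    exact    : IsExactColoring N k coloring
    noMono   : ¬ HasMonoSolution N k a b coloring

solutionFree⇒¬RadoProperty : ∀ {N k a b} →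
  SolutionFreeColoring N k a b → ¬ RadoProperty k a b N
solutionFree⇒¬RadoProperty (mkSolutionFree c exact noMono) (_ , rado) = noMono (rado c exact)

constant-solutionFree : ∀ {m a b} → suc m < suc a * 1 + b →
  SolutionFreeColoring (suc m) 1 (suc a) b
constant-solutionFree {m} {a} {b} m<image-of-1 =
  mkSolutionFree (λ _ → zero) (λ { zero → zero , refl }) noMono
  where
  noMono : ¬ HasMonoSolution (suc m) 1 (suc a) b (λ _ → zero)
  noMono (x , y , y≡ax+b , _) = <⇒≱ m<image-of-1 (begin
    suc a * 1 + b          ≤⟨ +-monoˡ-≤ b (*-monoʳ-≤ (suc a) (s≤s z≤n)) ⟩
    suc a * val x + b      ≡⟨ sym y≡ax+b ⟩
    val y                  ≤⟨ toℕ<n y ⟩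
    suc m                  ∎)
    where open ≤-Reasoning

addFreshColor : ∀ {N k} → (Fin N → Fin k) → Fin (suc N) → Fin (suc k)
addFreshColor {k = k} c i with view i
... | ‵fromℕ = fromℕ k
... | ‵inj₁ {i = j} _ = inject₁ (c j)

module _ {N k : ℕ} (c : Fin N → Fin k) where

  addFreshColor-fromℕ : addFreshColor c (fromℕ N) ≡ fromℕ k
  addFreshColor-fromℕ rewrite view-fromℕ N = refl

  addFreshColor-inject₁ : ∀ i → addFreshColor c (inject₁ i) ≡ inject₁ (c i)
  addFreshColor-inject₁ i rewrite view-inject₁ i = refl

  addFreshColor-exact :
    IsExactColoring N k c → IsExactColoring (suc N) (suc k) (addFreshColor c)
  addFreshColor-exact exact j with view j
  ... | ‵fromℕ = fromℕ N , addFreshColor-fromℕ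
  ... | ‵inj₁ {i = j′} _ with exact j′
  ...   | i , ci≡j′ = inject₁ i , trans (addFreshColor-inject₁ i) (cong inject₁ ci≡j′)

  val-inject₁ : ∀ (i : Fin N) → val (inject₁ i) ≡ val i
  val-inject₁ i = cong suc (toℕ-inject₁ i)

  addFreshColor-noMono : ∀ {a b} → Expanding a b → ¬ HasMonoSolution N k a b c →
    ¬ HasMonoSolution (suc N) (suc k) a b (addFreshColor c)
  addFreshColor-noMono {a} {b} expand noMono (x , y , y≡ax+b , cx≡cy) with view x | view y
  ... | ‵fromℕ | _ = <⇒≱ (expand (toℕ (fromℕ N))) (begin
    a * val (fromℕ N) + b  ≡⟨ sym y≡ax+b ⟩
    val y                  ≤⟨ toℕ<n y ⟩
    suc N                  ≡⟨ cong suc (sym (toℕ-fromℕ N)) ⟩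
    val (fromℕ N)          ∎)
    where open ≤-Reasoning
  ... | ‵inj₁ _ | ‵fromℕ = fromℕ≢inject₁ (sym cx≡cy)
  ... | ‵inj₁ {i = i} _ | ‵inj₁ {i = j} _ = noMono (i , j , j≡ai+b , inject₁-injective cx≡cy)
    where
    j≡ai+b : val j ≡ a * val i + b
    j≡ai+b = trans (sym (val-inject₁ j))
                   (trans y≡ax+b (cong (λ v → a * v + b) (val-inject₁ i)))

addFreshColor-solutionFree : ∀ {N k a b} → Expanding a b →
  SolutionFreeColoring N k a b → SolutionFreeColoring (suc N) (suc k) a b
addFreshColor-solutionFree {a = a} {b} expand (mkSolutionFree c exact noMono) =
  mkSolutionFree (addFreshColor c) (addFreshColor-exact c exact)
                 (addFreshColor-noMono c {a} {b} expand noMono)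

opposite-≢ : (i : Fin 2) → opposite i ≢ i
opposite-≢ zero ()
opposite-≢ (suc zero) ()

module ParityColoring (a′ b : ℕ) (expand : Expanding (suc a′) b) where

  private
    a : ℕ
    a = suc a′

  predecessor : ℕ → ℕ
  predecessor y = (y ∸ b) / a

  predecessor-inverse : ∀ x → predecessor (a * x + b) ≡ x
  predecessor-inverse x = begin
    (a * x + b ∸ b) / a  ≡⟨ cong (_/ a) (m+n∸n≡m (a * x) b) ⟩
    a * x / a            ≡⟨ cong (_/ a) (*-comm a x) ⟩
    x * a / a            ≡⟨ m*n/n≡m x a ⟩
    x                    ∎
    where open ≡-Reasoning

  predecessor-unique : ∀ {x y} → y ≡ a * x + b → predecessor y ≡ x
  predecessor-unique {x} y≡ax+b = trans (cong predecessor y≡ax+b) (predecessor-inverse x)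

  PositivePreimage : ℕ → Set
  PositivePreimage y = ∃[ x ] y ≡ a * suc x + b

  positivePreimage? : ∀ y → Dec (PositivePreimage y)
  positivePreimage? y with predecessor y in p≡
  ... | zero = no λ (x , y≡) → 0≢1+n (trans (sym p≡) (predecessor-unique y≡))
  ... | suc x with y ≟ a * suc x + b
  ...   | yes y≡ = yes (x , y≡)
  ...   | no y≢ = no λ (x′ , y≡) →
          y≢ (subst (λ z → y ≡ a * z + b) (trans (sym (predecessor-unique y≡)) p≡) y≡)

  -- The first argument is fuel: any value exceeding y gives the same result (parity-fuel).
  parity : ℕ → ℕ → Fin 2
  parity zero _ = zero
  parity (suc fuel) y with positivePreimage? y
  ... | yes (x , _) = opposite (parity fuel (suc x))
  ... | no _ = zero

  parity-fuel : ∀ {f g} y → y < f → y < g → parity f y ≡ parity g y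
  parity-fuel {suc f} {suc g} y (s≤s y≤f) (s≤s y≤g) with positivePreimage? y
  ... | no _ = refl
  ... | yes (x , y≡) =
    cong opposite (parity-fuel (suc x) (<-≤-trans x<y y≤f) (<-≤-trans x<y y≤g))
    where
    x<y : suc x < y
    x<y = subst (suc x <_) (sym y≡) (expand x)

  color : ℕ → Fin 2
  color y = parity (suc y) y

  color-1 : color 1 ≡ zero
  color-1 with positivePreimage? 1
  ... | no _ = refl
  ... | yes (x , 1≡) = contradiction (subst (suc x <_) (sym 1≡) (expand x)) (≤⇒≯ (s≤s z≤n))

  color-flips : ∀ x → color (a * suc x + b) ≡ opposite (color (suc x))
  color-flips x with positivePreimage? (a * suc x + b)
  ... | no ∄x = contradiction (x , refl) ∄x
  ... | yes (x′ , y≡)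
    with refl ← suc-injective (trans (sym (predecessor-inverse (suc x))) (predecessor-unique y≡)) =
    cong opposite (parity-fuel (suc x) (expand x) (n<1+n (suc x)))

  parity-solutionFree : ∀ {N} → a * 1 + b ≤ N → SolutionFreeColoring N 2 a b
  parity-solutionFree {N} image-of-1≤N = mkSolutionFree (λ i → color (val i)) exact noMono
    where
    colorAt : ∀ {t} (t<N : t < N) → color (val (fromℕ< t<N)) ≡ color (suc t)
    colorAt t<N = cong (λ t → color (suc t)) (toℕ-fromℕ< t<N)

    exact : IsExactColoring N 2 (λ i → color (val i))
    exact zero = fromℕ< 0<N , trans (colorAt 0<N) color-1
      where
      0<N : 0 < N
      0<N = <-≤-trans z<s image-of-1≤N
    exact (suc zero) = fromℕ< image-of-1≤N , (begin
      color (val (fromℕ< image-of-1≤N))  ≡⟨ colorAt image-of-1≤N ⟩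
      color (a * 1 + b)                  ≡⟨ color-flips 0 ⟩
      opposite (color 1)                 ≡⟨ cong opposite color-1 ⟩
      suc zero                           ∎)
      where open ≡-Reasoning

    noMono : ¬ HasMonoSolution N 2 a b (λ i → color (val i))
    noMono (x , y , y≡ax+b , cx≡cy) = opposite-≢ (color (val x)) (begin
      opposite (color (val x))   ≡⟨ sym (color-flips (toℕ x)) ⟩
      color (a * val x + b)      ≡⟨ cong color (sym y≡ax+b) ⟩
      color (val y)              ≡⟨ sym cx≡cy ⟩
      color (val x)              ∎)
      where open ≡-Reasoning

solutionFreeColoring : ∀ {a′ b} → Expanding (suc a′) b →
  ∀ d N → 2 + d ≤ N → SolutionFreeColoring N (2 + d) (suc a′) b
solutionFreeColoring {a′} {b} expand zero (suc (suc n)) (s≤s (s≤s z≤n))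
  with suc a′ * 1 + b ≤? suc (suc n)
... | yes image-of-1≤N = ParityColoring.parity-solutionFree a′ b expand image-of-1≤N
... | no image-of-1≰N =
  addFreshColor-solutionFree expand
    (constant-solutionFree (<-trans (n<1+n _) (≰⇒> image-of-1≰N)))
solutionFreeColoring expand (suc d) (suc N) (s≤s 2+d≤N) =
  addFreshColor-solutionFree expand (solutionFreeColoring expand d N 2+d≤N)

mainTheorem5 : (k a b : ℕ) → 2 ≤ k → 1 ≤ a → ¬ (a ≡ 1 × b ≡ 0)
    → ¬ RadoNumberExists k a b
mainTheorem5 (suc (suc d)) (suc a′) b (s≤s (s≤s z≤n)) 1≤a a,b≢1,0 (N , rado@(k≤N , _)) =
  solutionFree⇒¬RadoProperty
    (solutionFreeColoring {a′} {b} (expanding 1≤a a,b≢1,0) d N k≤N) rado
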